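{- Let $\mathcal{C}$ be a graph class and $k\ge 0$ an integer. If $\mathcal{C}$ has a distance-vector labelling scheme with labels of at most $k$ bits, then $\mathcal{C}$ has a distance labelling scheme with labels of at most $k$ bits.
   Context: $d_G(u,v)$ is the distance in $G$ (possibly $\infty$). $\{0,1\}^*$ is the set of finite binary strings and $(\mathbb{N}\cup\{\infty\})^*$ the set of finite sequences of elements of $\mathbb{N}\cup\{\infty\}$. A distance-vector labelling scheme for $\mathcal{C}$ with labels of at most $k$ bits is a function $D:\{0,1\}^*\to(\mathbb{N}\cup\{\infty\})^*$ such that for every $G\in\mathcal{C}$ there exist an ordering $v_1,\dots,v_n$ of $V(G)$ and a function $\ell_G:V(G)\to\{0,1\}^*$ with $|\ell_G(v)|\le k$ for all $v$, such that $D(\ell_G(v))=(d_G(v,v_1),\dots,d_G(v,v_n))$ for every $v\in V(G)$. A distance labelling scheme for $\mathcal{C}$ with labels of at most $k$ bits is a function $B:\{0,1\}^*\times\{0,1\}^*\to\mathbb{N}\cup\{\infty\}$ such that for every $G\in\mathcal{C}$ there is $\ell_G:V(G)\to\{0,1\}^*$ with $|\ell_G(v)|\le k$ for all $v$ and $B(\ell_G(u),\ell_G(v))=d_G(u,v)$ for all $u,v\in V(G)$. -}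

module Defs where

open import Data.Nat using (ℕ; zero; suc; _≤_; _<_)
open import Data.Bool using (Bool; true)
open import Data.Fin using (Fin)
open import Data.List using (List; length; map)
open import Data.List.Base using (allFin)
open import Data.Product using (Σ; _×_; ∃)
open import Data.Empty using (⊥)
open import Relation.Nullary using (¬_)
open import Relation.Binary.PropositionalEquality using (_≡_)
open import Function.Bundles using (_↔_; Inverse)
open import Function.Base using (_∘_)

data ℕ∞ : Set where
  fin : ℕ → ℕ∞
  ∞   : ℕ∞

record Graph : Set where
  field
    n      : ℕ
    adj    : Fin n → Fin n → Bool
    sym    : ∀ u v → adj u v ≡ adj v u
    irrefl : ∀ u → ¬ (adj u u ≡ true)
open Graph public

V : Graph → Set
V G = Fin (n G)

data Walk (G : Graph) : V G → V G → ℕ → Set where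
  here : ∀ {u} → Walk G u u zero
  step : ∀ {u w v m} → adj G u w ≡ true → Walk G w v m → Walk G u v (suc m)

data Dist (G : Graph) (u v : V G) : ℕ∞ → Set where
  dist-fin : ∀ {m} → Walk G u v m → (∀ {m'} → m' < m → ¬ Walk G u v m') → Dist G u v (fin m)
  dist-∞   : (∀ {m} → ¬ Walk G u v m) → Dist G u v ∞

data DistList (G : Graph) (v : V G) : List (V G) → List ℕ∞ → Set where
  []  : DistList G v Data.List.[] Data.List.[]
  _∷_ : ∀ {w ws d ds} → Dist G v w d → DistList G v ws ds →
        DistList G v (w Data.List.∷ ws) (d Data.List.∷ ds)

GraphClass : Set₁
GraphClass = Graph → Set

Label : Set
Label = List Bool

ordering : (G : Graph) → (Fin (n G) ↔ V G) → List (V G)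
ordering G σ = map (Inverse.to σ) (allFin (n G))

IsDistanceVectorScheme : GraphClass → ℕ → (Label → List ℕ∞) → Set
IsDistanceVectorScheme 𝒞 k D =
  ∀ G → 𝒞 G →
    Σ (Fin (n G) ↔ V G) λ σ →
    Σ (V G → Label) λ ℓ →
      (∀ v → length (ℓ v) ≤ k) × (∀ v → DistList G v (ordering G σ) (D (ℓ v)))

IsDistanceScheme : GraphClass → ℕ → (Label → Label → ℕ∞) → Set
IsDistanceScheme 𝒞 k B =
  ∀ G → 𝒞 G →
    Σ (V G → Label) λ ℓ →
      (∀ v → length (ℓ v) ≤ k) × (∀ u v → Dist G u v (B (ℓ u) (ℓ v)))

HasDistanceVectorScheme : GraphClass → ℕ → Set
HasDistanceVectorScheme 𝒞 k = ∃ λ D → IsDistanceVectorScheme 𝒞 k D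

HasDistanceScheme : GraphClass → ℕ → Set
HasDistanceScheme 𝒞 k = ∃ λ B → IsDistanceScheme 𝒞 k B

-- In the distance vector of v, the entry 0 occurs exactly at the position of v in the
-- ordering, since d(v,w) = 0 forces w = v. So the label of v alone tells where v sits in
-- the ordering, and d(u,v) is the entry of u's distance vector at that position.
module Submission where

open import Defs
open import Data.Nat using (ℕ; zero; suc; z<s)
open import Data.Fin using (Fin; toℕ)
open import Data.Maybe using (Maybe; just; nothing; maybe)
import Data.Maybe as Maybe
open import Data.List using (List; []; _∷_)
open import Data.List.Relation.Unary.Any using (here; there; index)
open import Data.List.Membership.Propositional using (_∈_)
open import Data.List.Membership.Propositional.Properties using (∈-map⁺; ∈-allFin)
open import Data.Product using (Σ; _,_)
open import Data.Empty using (⊥-elim)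
open import Relation.Nullary using (contradiction)
open import Relation.Binary.PropositionalEquality using (_≡_; refl; subst; cong)
open import Function.Bundles using (_↔_; Inverse)

firstZero : List ℕ∞ → Maybe ℕ
firstZero []             = nothing
firstZero (fin zero ∷ _) = just zero
firstZero (_ ∷ ds)       = Maybe.map suc (firstZero ds)

-- Out-of-range indices yield ∞; they never occur for labels of a graph in the class.
_!_ : List ℕ∞ → ℕ → ℕ∞
[]       ! _     = ∞
(d ∷ _)  ! zero  = d
(_ ∷ ds) ! suc i = ds ! i

decode : List ℕ∞ → List ℕ∞ → ℕ∞
decode du dv = maybe (du !_) ∞ (firstZero dv)

module _ {G : Graph} where

  Dist-self : ∀ {v d} → Dist G v v d → d ≡ fin zero
  Dist-self (dist-fin {zero} _ _)         = refl
  Dist-self (dist-fin {suc _} _ shortest) = ⊥-elim (shortest z<s here)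
  Dist-self (dist-∞ unreachable)          = ⊥-elim (unreachable here)

  Dist-zero⇒≡ : ∀ {u v} → Dist G u v (fin zero) → u ≡ v
  Dist-zero⇒≡ (dist-fin here _) = refl

  DistList-lookup : ∀ {u w ws es} → DistList G u ws es → (p : w ∈ ws) →
                    Dist G u w (es ! toℕ (index p))
  DistList-lookup (δ ∷ _)  (here refl) = δ
  DistList-lookup (_ ∷ δs) (there p)   = DistList-lookup δs p

  firstZero-locates : ∀ {v ws ds} → DistList G v ws ds → v ∈ ws →
                      Σ (v ∈ ws) λ p → firstZero ds ≡ just (toℕ (index p))
  firstZero-locates (_∷_ {d = fin zero} δ _) _ = here (Dist-zero⇒≡ δ) , refl
  firstZero-locates (_∷_ {d = fin (suc _)} δ _) (here refl) = contradiction (Dist-self δ) λ ()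
  firstZero-locates (_∷_ {d = fin (suc _)} _ δs) (there p) with firstZero-locates δs p
  ... | q , eq = there q , cong (Maybe.map suc) eq
  firstZero-locates (_∷_ {d = ∞} δ _) (here refl) = contradiction (Dist-self δ) λ ()
  firstZero-locates (_∷_ {d = ∞} _ δs) (there p) with firstZero-locates δs p
  ... | q , eq = there q , cong (Maybe.map suc) eq

  decode-correct : ∀ {u v ws du dv} → DistList G u ws du → DistList G v ws dv → v ∈ ws →
                   Dist G u v (decode du dv)
  decode-correct δu δv v∈ with firstZero-locates δv v∈
  ... | p , eq rewrite eq = DistList-lookup δu p

ordering-complete : ∀ G (σ : Fin (n G) ↔ V G) v → v ∈ ordering G σ
ordering-complete G σ v =
  subst (_∈ ordering G σ) (Inverse.strictlyInverseˡ σ v)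
        (∈-map⁺ (Inverse.to σ) (∈-allFin (Inverse.from σ v)))

proposition2p1 : (𝒞 : GraphClass) (k : ℕ) → HasDistanceVectorScheme 𝒞 k → HasDistanceScheme 𝒞 k
proposition2p1 𝒞 k (D , isScheme) = (λ a b → decode (D a) (D b)) , λ G G∈𝒞 →
  let σ , ℓ , short , vectors = isScheme G G∈𝒞
  in ℓ , short , λ u v → decode-correct (vectors u) (vectors v) (ordering-complete G σ v)
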